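{- Let $\alpha=(\alpha_1,\ldots,\alpha_k)\in\mathbb{Z}_{>0}^k$ and $n\geq1$. Then $\mathsf{Newton}(F_\alpha(x_1,\ldots,x_n))=\mathsf{Newton}(M_\alpha(x_1,\ldots,x_n))\subset\mathbb{R}^n$, and the vertices of this polytope are exactly the vectors in $\{\gamma\in\mathbb{Z}^n_{\geq0}:\gamma^+=\alpha\}$.
   Context: The monomial quasisymmetric function is $M_\alpha=\sum_{i_1<\cdots<i_k}x_{i_1}^{\alpha_1}\cdots x_{i_k}^{\alpha_k}$. Gessel's fundamental quasisymmetric function is $F_\alpha=\sum_{\beta\to\alpha}M_\beta$, where $\beta\to\alpha$ means that $\alpha$ is obtained from the composition $\beta$ by successively adding adjacent parts (including $\beta=\alpha$). $F_\alpha(x_1,\ldots,x_n)$ denotes the specialization $x_i=0$ for $i>n$. For $\gamma\in\mathbb{Z}^n_{\geq0}$, $\gamma^+$ is the composition obtained by deleting the zero entries of $\gamma$. $\mathsf{Newton}(f)$ is the convex hull of the exponent vectors of $f$.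
   Formalization: The Newton polytopes of $F_\alpha$ and $M_\alpha$, and their vertices, consist only of points with rational coordinates, formed with rational convex weights, instead of points in $\mathbb{R}^n$. -}

module Defs where

open import Data.Nat using (ℕ; zero; suc; _≡ᵇ_) renaming (_+_ to _+ℕ_; _<_ to _<ℕ_)
open import Data.Bool using (Bool; true; false; not; if_then_else_)
open import Data.Fin using (Fin) renaming (_<_ to _<F_)
open import Data.Fin.Properties using (_≟_)
open import Data.List using (List; []; _∷_; length; filterᵇ)
open import Data.List.Relation.Unary.All using (All)
open import Data.List.Relation.Unary.Linked using (Linked)
open import Data.Vec.Functional using (toList)
open import Data.Product using (Σ; _×_; _,_; ∃)
open import Data.Integer using (+_)
open import Data.Rational using (ℚ; _/_; _+_; _*_; _≤_; _<_; 0ℚ; 1ℚ; _-_)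
open import Relation.Binary.PropositionalEquality using (_≡_)
open import Relation.Binary.Construct.Closure.ReflexiveTransitive using (Star)
open import Relation.Nullary.Decidable using (⌊_⌋)

ExpVec : ℕ → Set
ExpVec n = Fin n → ℕ

Point : ℕ → Set
Point n = Fin n → ℚ

IsComposition : List ℕ → Set
IsComposition α = All (λ a → 0 <ℕ a) α

data MergeStep : List ℕ → List ℕ → Set where
  here  : ∀ {a b l} → MergeStep (a ∷ b ∷ l) ((a +ℕ b) ∷ l)
  there : ∀ {x l l'} → MergeStep l l' → MergeStep (x ∷ l) (x ∷ l')

_⟶_ : List ℕ → List ℕ → Set
β ⟶ α = Star MergeStep β α

monoExp : ∀ {n} → List ℕ → List (Fin n) → ExpVec n
monoExp (a ∷ as) (i ∷ is) j = (if ⌊ i ≟ j ⌋ then a else 0) +ℕ monoExp as is j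
monoExp _ _ j = 0

-- γ is the exponent vector of a term x_{i_1}^{α_1}⋯x_{i_k}^{α_k} (i_1<⋯<i_k ≤ n)
-- of M_α(x_1,…,x_n).  Every term has coefficient 1.
IsTermM : (α : List ℕ) (n : ℕ) → ExpVec n → Set
IsTermM α n γ = Σ (List (Fin n)) λ is →
  (length is ≡ length α) × Linked _<F_ is × (∀ j → γ j ≡ monoExp α is j)

suppM : (α : List ℕ) (n : ℕ) → ExpVec n → Set
suppM α n γ = IsTermM α n γ

-- Exponent vectors of monomials of F_α(x_1,…,x_n) = Σ_{β→α} M_β(x_1,…,x_n);
-- all coefficients are positive integers, so no cancellation occurs.
suppF : (α : List ℕ) (n : ℕ) → ExpVec n → Set
suppF α n γ = Σ (List ℕ) λ β → (β ⟶ α) × IsTermM β n γ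

_⁺ : ∀ {n} → ExpVec n → List ℕ
γ ⁺ = filterᵇ (λ x → not (x ≡ᵇ 0)) (toList γ)

toℚ : ∀ {n} → ExpVec n → Point n
toℚ γ j = (+ γ j) / 1

wsum : ∀ {n} → List (ℚ × ExpVec n) → Fin n → ℚ
wsum [] j = 0ℚ
wsum ((w , p) ∷ l) j = w * toℚ p j + wsum l j

wtotal : ∀ {n} → List (ℚ × ExpVec n) → ℚ
wtotal [] = 0ℚ
wtotal ((w , p) ∷ l) = w + wtotal l

Conv : ∀ {n} → (ExpVec n → Set) → Point n → Set
Conv {n} S x = Σ (List (ℚ × ExpVec n)) λ l →
  All (λ wp → (0ℚ ≤ Data.Product.proj₁ wp) × S (Data.Product.proj₂ wp)) l
  × (wtotal l ≡ 1ℚ) × (∀ j → x j ≡ wsum l j)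

NewtonM NewtonF : (α : List ℕ) (n : ℕ) → Point n → Set
NewtonM α n = Conv (suppM α n)
NewtonF α n = Conv (suppF α n)

IsVertex : ∀ {n} → (Point n → Set) → Point n → Set
IsVertex {n} P v = P v × (∀ (a b : Point n) (t : ℚ) → P a → P b → 0ℚ < t → t < 1ℚ →
  (∀ j → v j ≡ t * a j + (1ℚ - t) * b j) → (∀ j → a j ≡ v j) × (∀ j → b j ≡ v j))

module Submission where

-- The proof has two parts.
-- (1) Newton(F_α) = Newton(M_α).  "⊇" holds because M_α is one of the summands
--     of F_α.  For "⊆", merging adjacent parts a, b of β placed at indices i < i'
--     writes x_i^a x_i'^b ⋯ as the convex combination with weights a/(a+b) and
--     b/(a+b) of x_i^(a+b) ⋯ and x_i'^(a+b) ⋯, two monomials of the merged shape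
--     (merge).  Iterating along β → α and using transitivity of convex hulls
--     (conv-bind) puts every monomial of F_α into Newton(M_α).
-- (2) Vertices.  A vertex of a hull Conv S always is a point of S
--     (vertex⇒member), and the monomials of M_α are exactly the γ with γ⁺ = α
--     (term⇒⁺, ⁺⇒term).  Conversely such a γ is isolated: the only monomial of
--     M_α supported inside supp γ is γ itself, since γ⁺ determines γ on its
--     support (⁺-injective-on-support); and an isolated point of S is a vertex of
--     Conv S, because hull points vanishing off supp γ are multiples of γ
--     (isolated⇒vertex).

open import Defs

open import Data.Bool using (Bool; true; false; if_then_else_)
open import Data.Empty using (⊥-elim)
open import Data.Fin using (Fin; zero; suc)
import Data.Fin as Fin
import Data.Fin.Properties as Fin
import Data.Integer as ℤ
import Data.Integer.Properties as ℤₚ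
open import Data.List using (List; []; _∷_; length; map; _++_; filterᵇ)
open import Data.List.Properties using (tabulate-cong; ∷-injective; length-map)
open import Data.List.Relation.Binary.Sublist.Propositional using (_⊆_; []; _∷_; _∷ʳ_; ⊆-refl)
open import Data.List.Relation.Binary.Sublist.Propositional.Properties using (All-resp-⊆)
open import Data.List.Relation.Unary.All using (All; []; _∷_)
import Data.List.Relation.Unary.All as All
import Data.List.Relation.Unary.All.Properties as All
open import Data.List.Relation.Unary.AllPairs using (AllPairs; []; _∷_)
open import Data.List.Relation.Unary.Linked using (Linked; []; [-]; _∷_)
import Data.List.Relation.Unary.Linked as Linked
import Data.List.Relation.Unary.Linked.Properties as Linked
open import Data.Nat using (ℕ; zero; suc)
import Data.Nat as ℕ
import Data.Nat.Coprimality as Coprime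
import Data.Nat.Properties as ℕₚ
open import Data.Product using (Σ; _×_; _,_; proj₁; proj₂)
open import Data.Rational
  using (ℚ; mkℚ; 0ℚ; 1ℚ; _+_; _*_; _-_; -_; 1/_; _/_; _≤_; _<_; NonZero; ≢-nonZero; positive; nonNegative; ↥_)
import Data.Rational.Properties as ℚₚ
open import Data.Rational.Solver using (module +-*-Solver)
open import Data.Vec.Functional using (tail)
open import Function using (_∘_)
open import Function.Bundles using (_⇔_; mk⇔; Equivalence)
open import Function.Properties.Equivalence using () renaming (sym to ⇔-sym)
open import Relation.Binary.Construct.Closure.ReflexiveTransitive using (ε; _◅_)
open import Relation.Binary.Definitions using (Transitive; tri<; tri≈; tri>)
open import Relation.Binary.PropositionalEquality
open import Relation.Nullary using (yes; no)
open import Relation.Nullary.Decidable using (⌊_⌋)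

open +-*-Solver

ℕ→ℚ : ℕ → ℚ
ℕ→ℚ m = ℤ.+ m / 1

ℕ→ℚ-canonical : ∀ m → ℕ→ℚ m ≡ mkℚ (ℤ.+ m) 0 (Coprime.sym (Coprime.1-coprimeTo m))
ℕ→ℚ-canonical m = ℚₚ.↥p/↧p≡p _

ℕ→ℚ-+ : ∀ m n → ℕ→ℚ (m ℕ.+ n) ≡ ℕ→ℚ m + ℕ→ℚ n
ℕ→ℚ-+ m n rewrite ℕ→ℚ-canonical m | ℕ→ℚ-canonical n =
  cong (_/ 1) (sym (cong₂ ℤ._+_ (ℤₚ.*-identityʳ (ℤ.+ m)) (ℤₚ.*-identityʳ (ℤ.+ n))))

ℕ→ℚ-nonneg : ∀ m → 0ℚ ≤ ℕ→ℚ m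
ℕ→ℚ-nonneg m rewrite ℕ→ℚ-canonical m = ℚₚ.nonNegative⁻¹ _

ℕ→ℚ-zero : ∀ m → ℕ→ℚ m ≡ 0ℚ → m ≡ 0
ℕ→ℚ-zero m e rewrite ℕ→ℚ-canonical m with cong ↥_ e
... | refl = refl

*-nonneg : ∀ {x y} → 0ℚ ≤ x → 0ℚ ≤ y → 0ℚ ≤ x * y
*-nonneg {x} {y} 0≤x 0≤y = ℚₚ.nonNegative⁻¹ (x * y)
  {{ℚₚ.nonNeg*nonNeg⇒nonNeg x {{nonNegative 0≤x}} y {{nonNegative 0≤y}}}}

+-nonneg : ∀ {x y} → 0ℚ ≤ x → 0ℚ ≤ y → 0ℚ ≤ x + y
+-nonneg 0≤x 0≤y = ℚₚ.+-mono-≤ 0≤x 0≤y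

x≤x+y : ∀ {x y} → 0ℚ ≤ y → x ≤ x + y
x≤x+y {x} {y} 0≤y = subst (_≤ x + y) (ℚₚ.+-identityʳ x) (ℚₚ.+-monoʳ-≤ x 0≤y)

nonneg-sum≡0 : ∀ {x y} → 0ℚ ≤ x → 0ℚ ≤ y → x + y ≡ 0ℚ → (x ≡ 0ℚ) × (y ≡ 0ℚ)
nonneg-sum≡0 {x} {y} 0≤x 0≤y x+y≡0 =
  ℚₚ.≤-antisym (subst (x ≤_) x+y≡0 (x≤x+y 0≤y)) 0≤x ,
  ℚₚ.≤-antisym (subst (y ≤_) (trans (ℚₚ.+-comm y x) x+y≡0) (x≤x+y 0≤x)) 0≤y

pos⇒≢0 : ∀ {t} → 0ℚ < t → t ≢ 0ℚ
pos⇒≢0 0<t t≡0 = ℚₚ.<-irrefl (sym t≡0) 0<t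

0<1-t : ∀ {t} → t < 1ℚ → 0ℚ < 1ℚ - t
0<1-t {t} t<1 = subst (_< 1ℚ - t) (ℚₚ.+-inverseʳ t) (ℚₚ.+-monoˡ-< (- t) t<1)

*-cancel-≡0 : ∀ {w x} → w ≢ 0ℚ → w * x ≡ 0ℚ → x ≡ 0ℚ
*-cancel-≡0 {w} {x} w≢0 wx≡0 = begin
  x                ≡⟨ sym (ℚₚ.*-identityˡ x) ⟩
  1ℚ * x           ≡⟨ cong (_* x) (sym (ℚₚ.*-inverseˡ w)) ⟩
  1/ w * w * x     ≡⟨ ℚₚ.*-assoc (1/ w) w x ⟩
  1/ w * (w * x)   ≡⟨ cong (1/ w *_) wx≡0 ⟩
  1/ w * 0ℚ        ≡⟨ ℚₚ.*-zeroʳ (1/ w) ⟩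
  0ℚ               ∎
  where
  open ≡-Reasoning
  instance _ = ≢-nonZero w≢0

pos-comb≡0 : ∀ {t s x y} → 0ℚ < t → 0ℚ < s → 0ℚ ≤ x → 0ℚ ≤ y → t * x + s * y ≡ 0ℚ → (x ≡ 0ℚ) × (y ≡ 0ℚ)
pos-comb≡0 0<t 0<s 0≤x 0≤y tx+sy≡0
  with nonneg-sum≡0 (*-nonneg (ℚₚ.<⇒≤ 0<t) 0≤x) (*-nonneg (ℚₚ.<⇒≤ 0<s) 0≤y) tx+sy≡0
... | tx≡0 , sy≡0 = *-cancel-≡0 (pos⇒≢0 0<t) tx≡0 , *-cancel-≡0 (pos⇒≢0 0<s) sy≡0

weights-sum : ∀ {w₁ w₂} → w₁ + w₂ ≡ 1ℚ → ∀ y → y ≡ w₁ * y + w₂ * y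
weights-sum {w₁} {w₂} w₁+w₂≡1 y = begin
  y               ≡⟨ sym (ℚₚ.*-identityˡ y) ⟩
  1ℚ * y          ≡⟨ cong (_* y) (sym w₁+w₂≡1) ⟩
  (w₁ + w₂) * y   ≡⟨ ℚₚ.*-distribʳ-+ y w₁ w₂ ⟩
  w₁ * y + w₂ * y ∎
  where open ≡-Reasoning

tail-total : ∀ {w t} → w + t ≡ 1ℚ → t ≡ 1ℚ - w
tail-total {w} {t} w+t≡1 = trans (solve 2 (λ w t → t := (w :+ t) :- w) refl w t) (cong (_- w) w+t≡1)

WList : ℕ → Set
WList n = List (ℚ × ExpVec n)

Admissible : ∀ {n} → (ExpVec n → Set) → ℚ × ExpVec n → Set
Admissible S wp = (0ℚ ≤ proj₁ wp) × S (proj₂ wp)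

scale : ∀ {n} → ℚ → WList n → WList n
scale c [] = []
scale c ((w , p) ∷ l) = (c * w , p) ∷ scale c l

wtotal-scale : ∀ {n} c (l : WList n) → wtotal (scale c l) ≡ c * wtotal l
wtotal-scale c [] = sym (ℚₚ.*-zeroʳ c)
wtotal-scale c ((w , p) ∷ l) =
  trans (cong ((c * w) +_) (wtotal-scale c l)) (sym (ℚₚ.*-distribˡ-+ c w (wtotal l)))

wsum-scale : ∀ {n} c (l : WList n) j → wsum (scale c l) j ≡ c * wsum l j
wsum-scale c [] j = sym (ℚₚ.*-zeroʳ c)
wsum-scale c ((w , p) ∷ l) j =
  trans (cong₂ _+_ (ℚₚ.*-assoc c w (toℚ p j)) (wsum-scale c l j))
        (sym (ℚₚ.*-distribˡ-+ c (w * toℚ p j) (wsum l j)))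

scale-admissible : ∀ {n} {S : ExpVec n → Set} {c} → 0ℚ ≤ c →
  ∀ l → All (Admissible S) l → All (Admissible S) (scale c l)
scale-admissible 0≤c [] [] = []
scale-admissible 0≤c (_ ∷ l) ((0≤w , s) ∷ al) = (*-nonneg 0≤c 0≤w , s) ∷ scale-admissible 0≤c l al

wtotal-++ : ∀ {n} (l l' : WList n) → wtotal (l ++ l') ≡ wtotal l + wtotal l'
wtotal-++ [] l' = sym (ℚₚ.+-identityˡ _)
wtotal-++ ((w , p) ∷ l) l' =
  trans (cong (w +_) (wtotal-++ l l')) (sym (ℚₚ.+-assoc w (wtotal l) (wtotal l')))

wsum-++ : ∀ {n} (l l' : WList n) j → wsum (l ++ l') j ≡ wsum l j + wsum l' j
wsum-++ [] l' j = sym (ℚₚ.+-identityˡ _)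
wsum-++ ((w , p) ∷ l) l' j =
  trans (cong ((w * toℚ p j) +_) (wsum-++ l l' j)) (sym (ℚₚ.+-assoc (w * toℚ p j) (wsum l j) (wsum l' j)))

wtotal-nonneg : ∀ {n} {S : ExpVec n → Set} l → All (Admissible S) l → 0ℚ ≤ wtotal l
wtotal-nonneg [] [] = ℚₚ.≤-refl
wtotal-nonneg (_ ∷ l) ((0≤w , _) ∷ al) = +-nonneg 0≤w (wtotal-nonneg l al)

wsum-nonneg : ∀ {n} {S : ExpVec n → Set} l → All (Admissible S) l → ∀ j → 0ℚ ≤ wsum l j
wsum-nonneg [] [] j = ℚₚ.≤-refl
wsum-nonneg ((w , p) ∷ l) ((0≤w , _) ∷ al) j =
  +-nonneg (*-nonneg 0≤w (ℕ→ℚ-nonneg (p j))) (wsum-nonneg l al j)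

wtotal≡0⇒wsum≡0 : ∀ {n} {S : ExpVec n → Set} l → All (Admissible S) l → wtotal l ≡ 0ℚ → ∀ j → wsum l j ≡ 0ℚ
wtotal≡0⇒wsum≡0 [] [] _ j = refl
wtotal≡0⇒wsum≡0 ((w , p) ∷ l) ((0≤w , _) ∷ al) total≡0 j
  with nonneg-sum≡0 0≤w (wtotal-nonneg l al) total≡0
... | refl , rest≡0 = begin
  0ℚ * toℚ p j + wsum l j ≡⟨ cong₂ _+_ (ℚₚ.*-zeroˡ (toℚ p j)) (wtotal≡0⇒wsum≡0 l al rest≡0 j) ⟩
  0ℚ + 0ℚ                 ≡⟨ ℚₚ.+-identityʳ 0ℚ ⟩
  0ℚ                      ∎
  where open ≡-Reasoning

conv-resp : ∀ {n} {S : ExpVec n → Set} {x y : Point n} → (∀ j → y j ≡ x j) → Conv S x → Conv S y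
conv-resp y≗x (l , al , total , x≡) = l , al , total , λ j → trans (y≗x j) (x≡ j)

conv-mono : ∀ {n} {S T : ExpVec n → Set} → (∀ p → S p → T p) → ∀ {x} → Conv S x → Conv T x
conv-mono S⊆T (l , al , total , x≡) =
  l , All.map (λ { (0≤w , s) → 0≤w , S⊆T _ s }) al , total , x≡

conv-single : ∀ {n} {S : ExpVec n → Set} {p} → S p → Conv S (toℚ p)
conv-single {p = p} s =
  ((1ℚ , p) ∷ []) , (ℚₚ.nonNegative⁻¹ 1ℚ , s) ∷ [] , ℚₚ.+-identityʳ 1ℚ ,
  λ j → sym (trans (ℚₚ.+-identityʳ _) (ℚₚ.*-identityˡ _))

conv-pair : ∀ {n} {S : ExpVec n → Set} {p q w₁ w₂} → S p → S q →
  0ℚ ≤ w₁ → 0ℚ ≤ w₂ → w₁ + w₂ ≡ 1ℚ → Conv S (λ j → w₁ * toℚ p j + w₂ * toℚ q j)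
conv-pair {p = p} {q} {w₁} {w₂} sp sq 0≤w₁ 0≤w₂ w₁+w₂≡1 =
  ((w₁ , p) ∷ (w₂ , q) ∷ []) , (0≤w₁ , sp) ∷ (0≤w₂ , sq) ∷ [] ,
  trans (cong (w₁ +_) (ℚₚ.+-identityʳ w₂)) w₁+w₂≡1 ,
  λ j → cong ((w₁ * toℚ p j) +_) (sym (ℚₚ.+-identityʳ _))

refine : ∀ {n} {S T : ExpVec n → Set} → (∀ p → S p → Conv T (toℚ p)) →
  (l : WList n) → All (Admissible S) l →
  Σ (WList n) λ l' → All (Admissible T) l' × (wtotal l' ≡ wtotal l) × (∀ j → wsum l' j ≡ wsum l j)
refine S⊆convT [] [] = [] , [] , refl , λ j → refl
refine S⊆convT ((w , p) ∷ l) ((0≤w , s) ∷ al)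
  with S⊆convT p s | refine S⊆convT l al
... | lp , alp , totalp , p≡ | l' , al' , total' , sum' =
  scale w lp ++ l' ,
  All.++⁺ (scale-admissible 0≤w lp alp) al' ,
  trans (wtotal-++ (scale w lp) l')
        (cong₂ _+_ (trans (wtotal-scale w lp) (trans (cong (w *_) totalp) (ℚₚ.*-identityʳ w))) total') ,
  λ j → trans (wsum-++ (scale w lp) l' j)
              (cong₂ _+_ (trans (wsum-scale w lp j) (cong (w *_) (sym (p≡ j)))) (sum' j))

conv-bind : ∀ {n} {S T : ExpVec n → Set} → (∀ p → S p → Conv T (toℚ p)) → ∀ {x} → Conv S x → Conv T x
conv-bind S⊆convT (l , al , total , x≡) with refine S⊆convT l al
... | l' , al' , total' , sum' = l' , al' , trans total' total , λ j → trans (x≡ j) (sym (sum' j))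

conv-rescale : ∀ {n} {S : ExpVec n → Set} {c} l → All (Admissible S) l →
  0ℚ ≤ c → c * wtotal l ≡ 1ℚ → Conv S (λ j → c * wsum l j)
conv-rescale {c = c} l al 0≤c c*total≡1 =
  scale c l , scale-admissible 0≤c l al , trans (wtotal-scale c l) c*total≡1 , λ j → sym (wsum-scale c l j)

conv-nonneg : ∀ {n} {S : ExpVec n → Set} {x} → Conv S x → ∀ j → 0ℚ ≤ x j
conv-nonneg (l , al , _ , x≡) j = subst (0ℚ ≤_) (sym (x≡ j)) (wsum-nonneg l al j)

peel : ∀ {n} {S : ExpVec n → Set} {v : Point n} {w p} l → All (Admissible S) l →
  w + wtotal l ≡ 1ℚ → w < 1ℚ → (∀ j → v j ≡ w * toℚ p j + wsum l j) →
  Σ (Point n) λ b → Conv S b × (∀ j → v j ≡ w * toℚ p j + (1ℚ - w) * b j)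
peel {w = w} {p} l al total w<1 v≡ =
  (λ j → 1/ u * wsum l j) ,
  conv-rescale l al 0≤1/u (trans (cong (1/ u *_) (tail-total {w} total)) (ℚₚ.*-inverseˡ u)) ,
  λ j → trans (v≡ j) (cong ((w * toℚ p j) +_) (sym (u*[1/u*s]≡s (wsum l j))))
  where
  u : ℚ
  u = 1ℚ - w
  0<u : 0ℚ < u
  0<u = 0<1-t w<1
  instance
    u≢0 : NonZero u
    u≢0 = ≢-nonZero (pos⇒≢0 0<u)
  0≤1/u : 0ℚ ≤ 1/ u
  0≤1/u = ℚₚ.<⇒≤ (ℚₚ.positive⁻¹ 1/u {{ℚₚ.1/pos⇒pos u {{positive 0<u}}}})
    where 1/u : ℚ
          1/u = 1/ u
  u*[1/u*s]≡s : ∀ s → u * (1/ u * s) ≡ s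
  u*[1/u*s]≡s s = begin
    u * (1/ u * s) ≡⟨ sym (ℚₚ.*-assoc u (1/ u) s) ⟩
    u * 1/ u * s   ≡⟨ cong (_* s) (ℚₚ.*-inverseʳ u) ⟩
    1ℚ * s         ≡⟨ ℚₚ.*-identityˡ s ⟩
    s              ∎
    where open ≡-Reasoning

-- Walk along a representation of v:
-- entries of weight 0 are skipped, an entry of weight 1 is v itself, and an
-- entry of weight 0 < w < 1 equals v by extremality (peel).
vertex⇒member : ∀ {n} {S : ExpVec n → Set} {v} → IsVertex (Conv S) v →
  Σ (ExpVec n) λ p → S p × (∀ j → v j ≡ toℚ p j)
vertex⇒member {n} {S} {v} ((l₀ , al₀ , total₀ , v≡₀) , extreme) = go l₀ al₀ total₀ v≡₀
  where
  go : (l : WList n) → All (Admissible S) l → wtotal l ≡ 1ℚ → (∀ j → v j ≡ wsum l j) →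
       Σ (ExpVec n) λ p → S p × (∀ j → v j ≡ toℚ p j)
  go [] [] () _
  go ((w , p) ∷ l) ((0≤w , sp) ∷ al) total v≡ with ℚₚ.<-cmp 0ℚ w
  ... | tri> _ _ w<0 = ⊥-elim (ℚₚ.<-irrefl refl (ℚₚ.≤-<-trans 0≤w w<0))
  ... | tri≈ _ refl _ = go l al (trans (sym (ℚₚ.+-identityˡ _)) total)
    (λ j → trans (v≡ j) (trans (cong (_+ wsum l j) (ℚₚ.*-zeroˡ (toℚ p j))) (ℚₚ.+-identityˡ _)))
  ... | tri< 0<w _ _ with ℚₚ.<-cmp w 1ℚ
  ...   | tri> _ _ 1<w = ⊥-elim (ℚₚ.<-irrefl (sym total) (ℚₚ.<-≤-trans 1<w (x≤x+y (wtotal-nonneg l al))))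
  ...   | tri≈ _ refl _ = p , sp , λ j → begin
    v j                       ≡⟨ v≡ j ⟩
    1ℚ * toℚ p j + wsum l j   ≡⟨ cong (1ℚ * toℚ p j +_) (wtotal≡0⇒wsum≡0 l al rest≡0 j) ⟩
    1ℚ * toℚ p j + 0ℚ         ≡⟨ trans (ℚₚ.+-identityʳ _) (ℚₚ.*-identityˡ _) ⟩
    toℚ p j                   ∎
    where
    open ≡-Reasoning
    rest≡0 : wtotal l ≡ 0ℚ
    rest≡0 = trans (tail-total {1ℚ} total) (ℚₚ.+-inverseʳ 1ℚ)
  ...   | tri< w<1 _ _ =
    let b , b∈ , v≡wp+ub = peel {v = v} {w} {p} l al total w<1 v≡
    in  p , sp , λ j → sym (proj₁ (extreme (toℚ p) b w (conv-single {p = p} sp) b∈ 0<w w<1 v≡wp+ub) j)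

vertex-resp : ∀ {n} {P Q : Point n → Set} → (∀ x → P x ⇔ Q x) → ∀ {v} → IsVertex P v → IsVertex Q v
vertex-resp P⇔Q (v∈P , extreme) =
  Equivalence.to (P⇔Q _) v∈P ,
  λ a b t a∈Q b∈Q → extreme a b t (Equivalence.from (P⇔Q a) a∈Q) (Equivalence.from (P⇔Q b) b∈Q)

Isolated : ∀ {n} → (ExpVec n → Set) → ExpVec n → Set
Isolated S γ = ∀ p → S p → (∀ j → γ j ≡ 0 → p j ≡ 0) → ∀ j → p j ≡ γ j

-- For isolated γ, an admissible list whose barycentre vanishes off supp γ puts
-- positive weight only on γ, so its barycentre is (total weight) · γ.
collapse : ∀ {n} {S : ExpVec n → Set} {γ} → Isolated S γ → ∀ l → All (Admissible S) l →
  (∀ j → γ j ≡ 0 → wsum l j ≡ 0ℚ) → ∀ j → wsum l j ≡ wtotal l * toℚ γ j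
collapse {γ = γ} iso [] [] _ j = sym (ℚₚ.*-zeroˡ (toℚ γ j))
collapse {γ = γ} iso ((w , p) ∷ l) ((0≤w , sp) ∷ al) vanish j =
  trans (cong₂ _+_ (head≡ j) (collapse iso l al (λ k γk≡0 → proj₂ (parts-vanish k γk≡0)) j))
        (sym (ℚₚ.*-distribʳ-+ (toℚ γ j) w (wtotal l)))
  where
  parts-vanish : ∀ k → γ k ≡ 0 → (w * toℚ p k ≡ 0ℚ) × (wsum l k ≡ 0ℚ)
  parts-vanish k γk≡0 =
    nonneg-sum≡0 (*-nonneg 0≤w (ℕ→ℚ-nonneg (p k))) (wsum-nonneg l al k) (vanish k γk≡0)
  head≡ : ∀ k → w * toℚ p k ≡ w * toℚ γ k
  head≡ k with w ℚₚ.≟ 0ℚ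
  ... | yes refl = trans (ℚₚ.*-zeroˡ (toℚ p k)) (sym (ℚₚ.*-zeroˡ (toℚ γ k)))
  ... | no w≢0 = cong (λ m → w * ℕ→ℚ m) (iso p sp p-vanishes k)
    where
    p-vanishes : ∀ k' → γ k' ≡ 0 → p k' ≡ 0
    p-vanishes k' γk'≡0 = ℕ→ℚ-zero (p k') (*-cancel-≡0 w≢0 (proj₁ (parts-vanish k' γk'≡0)))

-- An isolated point of S is a vertex of Conv S: if v = t a + (1-t) b with
-- 0 < t < 1, then a and b vanish off supp γ and hence equal v by collapse.
isolated⇒vertex : ∀ {n} {S : ExpVec n → Set} {γ} {v : Point n} → S γ → Isolated S γ →
  (∀ j → v j ≡ toℚ γ j) → IsVertex (Conv S) v
isolated⇒vertex {n} {S} {γ} {v} sγ iso v≡γ = conv-resp v≡γ (conv-single {p = γ} sγ) , extreme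
  where
  equals-v : ∀ {x} → Conv S x → (∀ j → γ j ≡ 0 → x j ≡ 0ℚ) → ∀ j → x j ≡ v j
  equals-v {x} (l , al , total , x≡) x-vanish j = begin
    x j                  ≡⟨ x≡ j ⟩
    wsum l j             ≡⟨ collapse iso l al (λ k γk≡0 → trans (sym (x≡ k)) (x-vanish k γk≡0)) j ⟩
    wtotal l * toℚ γ j   ≡⟨ cong (_* toℚ γ j) total ⟩
    1ℚ * toℚ γ j         ≡⟨ ℚₚ.*-identityˡ (toℚ γ j) ⟩
    toℚ γ j              ≡⟨ sym (v≡γ j) ⟩
    v j                  ∎
    where open ≡-Reasoning
  extreme : ∀ a b t → Conv S a → Conv S b → 0ℚ < t → t < 1ℚ →
    (∀ j → v j ≡ t * a j + (1ℚ - t) * b j) → (∀ j → a j ≡ v j) × (∀ j → b j ≡ v j)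
  extreme a b t a∈ b∈ 0<t t<1 v≡ =
    equals-v a∈ (λ j γj≡0 → proj₁ (vanish j γj≡0)) , equals-v b∈ (λ j γj≡0 → proj₂ (vanish j γj≡0))
    where
    vanish : ∀ j → γ j ≡ 0 → (a j ≡ 0ℚ) × (b j ≡ 0ℚ)
    vanish j γj≡0 = pos-comb≡0 0<t (0<1-t t<1) (conv-nonneg a∈ j) (conv-nonneg b∈ j)
      (trans (sym (v≡ j)) (trans (v≡γ j) (cong ℕ→ℚ γj≡0)))

⁺-cong : ∀ {n} {f g : ExpVec n} → (∀ j → f j ≡ g j) → f ⁺ ≡ g ⁺
⁺-cong f≗g = cong (filterᵇ _) (tabulate-cong f≗g)

⁺-head-zero : ∀ {n} (γ : ExpVec (suc n)) → γ zero ≡ 0 → γ ⁺ ≡ tail γ ⁺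
⁺-head-zero γ γ₀≡0 rewrite γ₀≡0 = refl

⁺-head-suc : ∀ {n} (γ : ExpVec (suc n)) {a} → γ zero ≡ suc a → γ ⁺ ≡ suc a ∷ tail γ ⁺
⁺-head-suc γ γ₀≡1+a rewrite γ₀≡1+a = refl

length-⁺-mono : ∀ {n} (f g : ExpVec n) → (∀ j → f j ≡ 0 → g j ≡ 0) → length (g ⁺) ℕ.≤ length (f ⁺)
length-⁺-mono {zero} f g _ = ℕ.z≤n
length-⁺-mono {suc n} f g supp⊆ with f zero in f₀≡ | g zero in g₀≡
... | zero  | zero  = length-⁺-mono (tail f) (tail g) (supp⊆ ∘ suc)
... | zero  | suc b with () ← trans (sym g₀≡) (supp⊆ zero f₀≡)
... | suc a | zero  = ℕₚ.m≤n⇒m≤1+n (length-⁺-mono (tail f) (tail g) (supp⊆ ∘ suc))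
... | suc a | suc b = ℕ.s≤s (length-⁺-mono (tail f) (tail g) (supp⊆ ∘ suc))

⁺-injective-on-support : ∀ {n} (f g : ExpVec n) → (∀ j → f j ≡ 0 → g j ≡ 0) → f ⁺ ≡ g ⁺ → ∀ j → g j ≡ f j
⁺-injective-on-support {suc n} f g supp⊆ f⁺≡g⁺ j with f zero in f₀≡ | g zero in g₀≡ | j
... | zero  | zero  | zero  = trans g₀≡ (sym f₀≡)
... | zero  | zero  | suc k = ⁺-injective-on-support (tail f) (tail g) (supp⊆ ∘ suc) f⁺≡g⁺ k
... | zero  | suc b | _ with () ← trans (sym g₀≡) (supp⊆ zero f₀≡)
... | suc a | zero  | _ = ⊥-elim (ℕₚ.<-irrefl refl (begin-strict
  length (tail g ⁺)       ≤⟨ length-⁺-mono (tail f) (tail g) (supp⊆ ∘ suc) ⟩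
  length (tail f ⁺)       <⟨ ℕₚ.n<1+n _ ⟩
  suc (length (tail f ⁺)) ≡⟨ cong length f⁺≡g⁺ ⟩
  length (tail g ⁺)       ∎))
  where open ℕₚ.≤-Reasoning
... | suc a | suc b | zero  = trans g₀≡ (trans (sym (proj₁ (∷-injective f⁺≡g⁺))) (sym f₀≡))
... | suc a | suc b | suc k =
  ⁺-injective-on-support (tail f) (tail g) (supp⊆ ∘ suc) (proj₂ (∷-injective f⁺≡g⁺)) k

Increasing : ∀ {n} → List (Fin n) → Set
Increasing = Linked Fin._<_

monoExp-shift-zero : ∀ {n} as (is : List (Fin n)) → monoExp as (map suc is) zero ≡ 0
monoExp-shift-zero [] is = refl
monoExp-shift-zero (a ∷ as) [] = refl
monoExp-shift-zero (a ∷ as) (i ∷ is) = monoExp-shift-zero as is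

monoExp-shift-suc : ∀ {n} as (is : List (Fin n)) j → monoExp as (map suc is) (suc j) ≡ monoExp as is j
monoExp-shift-suc [] is j = refl
monoExp-shift-suc (a ∷ as) [] j = refl
monoExp-shift-suc (a ∷ as) (i ∷ is) j rewrite monoExp-shift-suc as is j with i Fin.≟ j
... | yes _ = refl
... | no _ = refl

monoExp-cons-zero : ∀ {n} a as (is : List (Fin n)) → monoExp (a ∷ as) (zero ∷ map suc is) zero ≡ a
monoExp-cons-zero a as is = trans (cong (a ℕ.+_) (monoExp-shift-zero as is)) (ℕₚ.+-identityʳ a)

shift-increasing : ∀ {n} {is : List (Fin n)} → Increasing is → Increasing (map suc is)
shift-increasing inc = Linked.map⁺ (Linked.map ℕ.s≤s inc)

zero-increasing : ∀ {n} {is : List (Fin n)} → Increasing is → Increasing (zero ∷ map suc is)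
zero-increasing {is = []} _ = [-]
zero-increasing {is = _ ∷ _} inc = ℕ.s≤s ℕ.z≤n ∷ shift-increasing inc

data IncreasingView {n} : List (Fin (suc n)) → Set where
  shifted      : ∀ {is} → Increasing is → IncreasingView (map suc is)
  zero∷shifted : ∀ {is} → Increasing is → IncreasingView (zero ∷ map suc is)

all-suc : ∀ {n} (i : Fin n) is → Increasing (suc i ∷ is) →
  Σ (List (Fin n)) λ is' → (is ≡ map suc is') × Increasing (i ∷ is')
all-suc i [] _ = [] , refl , [-]
all-suc i (zero ∷ is) (() ∷ _)
all-suc i (suc j ∷ is) (ℕ.s≤s i<j ∷ inc) with all-suc j is inc
... | is' , refl , inc' = j ∷ is' , refl , i<j ∷ inc'

view : ∀ {n} (is : List (Fin (suc n))) → Increasing is → IncreasingView is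
view [] _ = shifted {is = []} []
view (zero ∷ []) _ = zero∷shifted {is = []} []
view (zero ∷ zero ∷ is) (() ∷ _)
view (zero ∷ suc j ∷ is) (_ ∷ inc) with all-suc j is inc
... | is' , refl , inc' = zero∷shifted inc'
view (suc i ∷ is) inc with all-suc i is inc
... | is' , refl , inc' = shifted inc'

-- The exponent vector of x_{i₁}^{α₁}⋯x_{i_k}^{α_k} with i₁ < ⋯ < i_k has γ⁺ = α,
-- because the parts of a composition are positive.
monoExp⁺ : ∀ {n} α (is : List (Fin n)) → IsComposition α → length is ≡ length α → Increasing is →
  monoExp α is ⁺ ≡ α
monoExp⁺ {zero} [] [] _ _ _ = refl
monoExp⁺ {suc n} α is posα len inc with view is inc
... | shifted {is'} inc' = begin
  γ ⁺                ≡⟨ ⁺-head-zero γ (monoExp-shift-zero α is') ⟩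
  tail γ ⁺           ≡⟨ ⁺-cong (monoExp-shift-suc α is') ⟩
  monoExp α is' ⁺    ≡⟨ monoExp⁺ α is' posα (trans (sym (length-map suc is')) len) inc' ⟩
  α                  ∎
  where
  open ≡-Reasoning
  γ = monoExp α (map suc is')
monoExp⁺ {suc n} (suc a ∷ α) _ (_ ∷ posα) len _ | zero∷shifted {is'} inc' = begin
  γ ⁺                       ≡⟨ ⁺-head-suc γ (monoExp-cons-zero (suc a) α is') ⟩
  suc a ∷ tail γ ⁺          ≡⟨ cong (suc a ∷_) (⁺-cong (monoExp-shift-suc α is')) ⟩
  suc a ∷ monoExp α is' ⁺   ≡⟨ cong (suc a ∷_) (monoExp⁺ α is' posα len′ inc') ⟩
  suc a ∷ α                 ∎
  where
  open ≡-Reasoning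
  γ = monoExp (suc a ∷ α) (zero ∷ map suc is')
  len′ : length is' ≡ length α
  len′ = trans (sym (length-map suc is')) (ℕₚ.suc-injective len)

term⇒⁺ : ∀ {n} α → IsComposition α → (γ : ExpVec n) → IsTermM α n γ → γ ⁺ ≡ α
term⇒⁺ α posα γ (is , len , inc , γ≡) = trans (⁺-cong γ≡) (monoExp⁺ α is posα len inc)

⁺⇒term : ∀ {n} (γ : ExpVec n) α → γ ⁺ ≡ α → IsTermM α n γ
⁺⇒term {zero} γ .[] refl = [] , refl , [] , λ ()
⁺⇒term {suc n} γ α γ⁺≡α with γ zero in γ₀≡
... | zero with ⁺⇒term (tail γ) α γ⁺≡α
...   | is , len , inc , tail≡ = map suc is , trans (length-map suc is) len , shift-increasing inc , γ≡
  where
  γ≡ : ∀ j → γ j ≡ monoExp α (map suc is) j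
  γ≡ zero = trans γ₀≡ (sym (monoExp-shift-zero α is))
  γ≡ (suc j) = trans (tail≡ j) (sym (monoExp-shift-suc α is j))
⁺⇒term {suc n} γ _ refl | suc a with ⁺⇒term (tail γ) (tail γ ⁺) refl
... | is , len , inc , tail≡ =
  zero ∷ map suc is , cong suc (trans (length-map suc is) len) , zero-increasing inc , γ≡
  where
  γ≡ : ∀ j → γ j ≡ monoExp (suc a ∷ tail γ ⁺) (zero ∷ map suc is) j
  γ≡ zero = trans γ₀≡ (sym (monoExp-cons-zero (suc a) (tail γ ⁺) is))
  γ≡ (suc j) = trans (tail≡ j) (sym (monoExp-shift-suc (tail γ ⁺) is j))

term-isolated : ∀ {n} α → IsComposition α → {γ : ExpVec n} → γ ⁺ ≡ α → Isolated (IsTermM α n) γ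
term-isolated α posα {γ} γ⁺≡α p tp supp⊆ =
  ⁺-injective-on-support γ p supp⊆ (trans γ⁺≡α (sym (term⇒⁺ α posα p tp)))

-- Sublists of lists linked by a transitive relation are linked (via AllPairs);
-- merging deletes an index, which keeps index lists increasing.
linked-⊆ : ∀ {a r} {A : Set a} {R : A → A → Set r} → Transitive R →
  ∀ {xs ys} → xs ⊆ ys → Linked R ys → Linked R xs
linked-⊆ {R = R} R-trans xs⊆ys = Linked.AllPairs⇒Linked ∘ allPairs-⊆ xs⊆ys ∘ Linked.Linked⇒AllPairs R-trans
  where
  allPairs-⊆ : ∀ {xs ys} → xs ⊆ ys → AllPairs R ys → AllPairs R xs
  allPairs-⊆ [] [] = []
  allPairs-⊆ (_ ∷ʳ s) (_ ∷ ps) = allPairs-⊆ s ps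
  allPairs-⊆ (refl ∷ s) (p ∷ ps) = All-resp-⊆ s p ∷ allPairs-⊆ s ps

-- Weights splitting a + b into a and b; when a + b = 0 any weights work, we take (1, 0).
record SplitWeights (a b : ℕ) : Set where
  field
    w₁ w₂   : ℚ
    w₁≥0    : 0ℚ ≤ w₁
    w₂≥0    : 0ℚ ≤ w₂
    w₁+w₂≡1 : w₁ + w₂ ≡ 1ℚ
    w₁-part : w₁ * ℕ→ℚ (a ℕ.+ b) ≡ ℕ→ℚ a
    w₂-part : w₂ * ℕ→ℚ (a ℕ.+ b) ≡ ℕ→ℚ b

split-weights : ∀ a b → SplitWeights a b
split-weights a b with a ℕ.+ b in a+b≡
... | zero = record
  { w₁ = 1ℚ ; w₂ = 0ℚ ; w₁≥0 = ℚₚ.nonNegative⁻¹ 1ℚ ; w₂≥0 = ℚₚ.≤-refl ; w₁+w₂≡1 = ℚₚ.+-identityʳ 1ℚ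
  ; w₁-part = trans (ℚₚ.*-identityˡ (ℕ→ℚ (a ℕ.+ b))) (cong ℕ→ℚ (trans a+b≡ (sym (ℕₚ.m+n≡0⇒m≡0 a a+b≡))))
  ; w₂-part = trans (ℚₚ.*-zeroˡ (ℕ→ℚ (a ℕ.+ b))) (cong ℕ→ℚ (sym (ℕₚ.m+n≡0⇒n≡0 a a+b≡))) }
... | suc k = record
  { w₁ = ℕ→ℚ a * 1/s ; w₂ = ℕ→ℚ b * 1/s
  ; w₁≥0 = *-nonneg (ℕ→ℚ-nonneg a) 0≤1/s ; w₂≥0 = *-nonneg (ℕ→ℚ-nonneg b) 0≤1/s
  ; w₁+w₂≡1 = begin
      ℕ→ℚ a * 1/s + ℕ→ℚ b * 1/s ≡⟨ sym (ℚₚ.*-distribʳ-+ 1/s (ℕ→ℚ a) (ℕ→ℚ b)) ⟩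
      (ℕ→ℚ a + ℕ→ℚ b) * 1/s     ≡⟨ cong (_* 1/s) (trans (sym (ℕ→ℚ-+ a b)) ℕ→ℚ[a+b]≡s) ⟩
      s * 1/s                   ≡⟨ ℚₚ.*-inverseʳ s ⟩
      1ℚ                        ∎
  ; w₁-part = part a ; w₂-part = part b }
  where
  open ≡-Reasoning
  s : ℚ
  s = mkℚ (ℤ.+ suc k) 0 (Coprime.sym (Coprime.1-coprimeTo (suc k)))
  1/s : ℚ
  1/s = 1/ s
  0≤1/s : 0ℚ ≤ 1/s
  0≤1/s = ℚₚ.nonNegative⁻¹ 1/s
  ℕ→ℚ[a+b]≡s : ℕ→ℚ (a ℕ.+ b) ≡ s
  ℕ→ℚ[a+b]≡s = trans (cong ℕ→ℚ a+b≡) (ℕ→ℚ-canonical (suc k))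
  part : ∀ m → ℕ→ℚ m * 1/s * ℕ→ℚ (a ℕ.+ b) ≡ ℕ→ℚ m
  part m = begin
    ℕ→ℚ m * 1/s * ℕ→ℚ (a ℕ.+ b) ≡⟨ cong (ℕ→ℚ m * 1/s *_) ℕ→ℚ[a+b]≡s ⟩
    ℕ→ℚ m * 1/s * s           ≡⟨ ℚₚ.*-assoc (ℕ→ℚ m) 1/s s ⟩
    ℕ→ℚ m * (1/s * s)         ≡⟨ cong (ℕ→ℚ m *_) (ℚₚ.*-inverseˡ s) ⟩
    ℕ→ℚ m * 1ℚ                ≡⟨ ℚₚ.*-identityʳ (ℕ→ℚ m) ⟩
    ℕ→ℚ m                     ∎

scale-if : ∀ (c : Bool) {w m k} → w * ℕ→ℚ m ≡ ℕ→ℚ k →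
  w * ℕ→ℚ (if c then m else 0) ≡ ℕ→ℚ (if c then k else 0)
scale-if true wm≡k = wm≡k
scale-if false {w} _ = ℚₚ.*-zeroʳ w

-- Coordinatewise identity behind merging parts a, b at indices i, i': at a
-- coordinate j with c = [i = j], c' = [i' = j] and remaining exponent r.
merge-coordinate : ∀ (c c' : Bool) a b r (sw : SplitWeights a b) → let open SplitWeights sw in
  ℕ→ℚ ((if c then a else 0) ℕ.+ ((if c' then b else 0) ℕ.+ r)) ≡
  w₁ * ℕ→ℚ ((if c then a ℕ.+ b else 0) ℕ.+ r) + w₂ * ℕ→ℚ ((if c' then a ℕ.+ b else 0) ℕ.+ r)
merge-coordinate c c' a b r sw = begin
  ℕ→ℚ (A ℕ.+ (B ℕ.+ r))
    ≡⟨ trans (ℕ→ℚ-+ A (B ℕ.+ r)) (cong (ℕ→ℚ A +_) (ℕ→ℚ-+ B r)) ⟩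
  ℕ→ℚ A + (ℕ→ℚ B + ℕ→ℚ r)
    ≡⟨ cong₂ _+_ (sym (scale-if c {w₁} {a ℕ.+ b} w₁-part))
                 (cong₂ _+_ (sym (scale-if c' {w₂} {a ℕ.+ b} w₂-part)) (weights-sum {w₁} {w₂} w₁+w₂≡1 (ℕ→ℚ r))) ⟩
  w₁ * ℕ→ℚ A' + (w₂ * ℕ→ℚ B' + (w₁ * ℕ→ℚ r + w₂ * ℕ→ℚ r))
    ≡⟨ solve 5 (λ w₁ w₂ A' B' R → w₁ :* A' :+ (w₂ :* B' :+ (w₁ :* R :+ w₂ :* R)) :=
                                  w₁ :* (A' :+ R) :+ w₂ :* (B' :+ R)) refl w₁ w₂ (ℕ→ℚ A') (ℕ→ℚ B') (ℕ→ℚ r) ⟩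
  w₁ * (ℕ→ℚ A' + ℕ→ℚ r) + w₂ * (ℕ→ℚ B' + ℕ→ℚ r)
    ≡⟨ sym (cong₂ (λ u v → w₁ * u + w₂ * v) (ℕ→ℚ-+ A' r) (ℕ→ℚ-+ B' r)) ⟩
  w₁ * ℕ→ℚ (A' ℕ.+ r) + w₂ * ℕ→ℚ (B' ℕ.+ r) ∎
  where
  open SplitWeights sw
  open ≡-Reasoning
  A = if c then a else 0
  B = if c' then b else 0
  A' = if c then a ℕ.+ b else 0
  B' = if c' then a ℕ.+ b else 0

shift-coordinate : ∀ (x m m₁ m₂ : ℕ) {w₁ w₂} → w₁ + w₂ ≡ 1ℚ →
  ℕ→ℚ m ≡ w₁ * ℕ→ℚ m₁ + w₂ * ℕ→ℚ m₂ → ℕ→ℚ (x ℕ.+ m) ≡ w₁ * ℕ→ℚ (x ℕ.+ m₁) + w₂ * ℕ→ℚ (x ℕ.+ m₂)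
shift-coordinate x m m₁ m₂ {w₁} {w₂} w₁+w₂≡1 m≡ = begin
  ℕ→ℚ (x ℕ.+ m)
    ≡⟨ ℕ→ℚ-+ x m ⟩
  ℕ→ℚ x + ℕ→ℚ m
    ≡⟨ cong₂ _+_ (weights-sum {w₁} {w₂} w₁+w₂≡1 (ℕ→ℚ x)) m≡ ⟩
  (w₁ * ℕ→ℚ x + w₂ * ℕ→ℚ x) + (w₁ * ℕ→ℚ m₁ + w₂ * ℕ→ℚ m₂)
    ≡⟨ solve 5 (λ w₁ w₂ X M₁ M₂ → (w₁ :* X :+ w₂ :* X) :+ (w₁ :* M₁ :+ w₂ :* M₂) :=
                                  w₁ :* (X :+ M₁) :+ w₂ :* (X :+ M₂)) refl w₁ w₂ (ℕ→ℚ x) (ℕ→ℚ m₁) (ℕ→ℚ m₂) ⟩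
  w₁ * (ℕ→ℚ x + ℕ→ℚ m₁) + w₂ * (ℕ→ℚ x + ℕ→ℚ m₂)
    ≡⟨ sym (cong₂ (λ u v → w₁ * u + w₂ * v) (ℕ→ℚ-+ x m₁) (ℕ→ℚ-+ x m₂)) ⟩
  w₁ * ℕ→ℚ (x ℕ.+ m₁) + w₂ * ℕ→ℚ (x ℕ.+ m₂) ∎
  where open ≡-Reasoning

record MergeSplit {n} (β' : List ℕ) (is : List (Fin n)) (x : Point n) : Set where
  field
    w₁ w₂   : ℚ
    w₁≥0    : 0ℚ ≤ w₁
    w₂≥0    : 0ℚ ≤ w₂
    w₁+w₂≡1 : w₁ + w₂ ≡ 1ℚ
    is₁ is₂ : List (Fin n)
    is₁⊆is  : is₁ ⊆ is
    is₂⊆is  : is₂ ⊆ is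
    length₁ : length is₁ ≡ length β'
    length₂ : length is₂ ≡ length β'
    x≡      : ∀ j → x j ≡ w₁ * toℚ (monoExp β' is₁) j + w₂ * toℚ (monoExp β' is₂) j

-- Merging adjacent parts a, b at indices i < i' splits x_i^a x_i'^b ⋯ into
-- x_i^(a+b) ⋯ and x_i'^(a+b) ⋯; merging further right keeps the leading factor.
merge : ∀ {n β β'} → MergeStep β β' → (is : List (Fin n)) → length is ≡ length β →
  MergeSplit β' is (toℚ (monoExp β is))
merge (here {a} {b} {l}) (i ∷ i' ∷ is) len = record
  { w₁ = w₁ ; w₂ = w₂ ; w₁≥0 = w₁≥0 ; w₂≥0 = w₂≥0 ; w₁+w₂≡1 = w₁+w₂≡1
  ; is₁ = i ∷ is ; is₂ = i' ∷ is
  ; is₁⊆is = refl ∷ (i' ∷ʳ ⊆-refl) ; is₂⊆is = i ∷ʳ ⊆-refl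
  ; length₁ = ℕₚ.suc-injective len ; length₂ = ℕₚ.suc-injective len
  ; x≡ = λ j → merge-coordinate ⌊ i Fin.≟ j ⌋ ⌊ i' Fin.≟ j ⌋ a b (monoExp l is j) sw }
  where
  sw = split-weights a b
  open SplitWeights sw
merge (there {x} {β} step) (i ∷ is) len = record
  { w₁ = w₁ ; w₂ = w₂ ; w₁≥0 = w₁≥0 ; w₂≥0 = w₂≥0 ; w₁+w₂≡1 = w₁+w₂≡1
  ; is₁ = i ∷ is₁ ; is₂ = i ∷ is₂
  ; is₁⊆is = refl ∷ is₁⊆is ; is₂⊆is = refl ∷ is₂⊆is
  ; length₁ = cong suc length₁ ; length₂ = cong suc length₂
  ; x≡ = λ j → shift-coordinate (if ⌊ i Fin.≟ j ⌋ then x else 0) (monoExp β is j) _ _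
                                {w₁} {w₂} w₁+w₂≡1 (x≡ j) }
  where open MergeSplit (merge step is (ℕₚ.suc-injective len))

-- If β → α then every monomial of M_β lies in Newton(M_α): split along each
-- merge step and compose by transitivity of hulls.
term∈NewtonM : ∀ {n β α} → β ⟶ α → (p : ExpVec n) → IsTermM β n p → Conv (IsTermM α n) (toℚ p)
term∈NewtonM ε p tm = conv-single {p = p} tm
term∈NewtonM {n} (_◅_ {j = β'} step steps) p (is , len , inc , p≡) =
  conv-bind (term∈NewtonM steps)
    (conv-resp p≡combination (conv-pair {p = q₁} {q₂} {w₁} {w₂} t₁ t₂ w₁≥0 w₂≥0 w₁+w₂≡1))
  where
  open MergeSplit (merge step is len)
  q₁ q₂ : ExpVec n
  q₁ = monoExp β' is₁
  q₂ = monoExp β' is₂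
  t₁ : IsTermM β' n q₁
  t₁ = is₁ , length₁ , linked-⊆ Fin.<-trans is₁⊆is inc , λ j → refl
  t₂ : IsTermM β' n q₂
  t₂ = is₂ , length₂ , linked-⊆ Fin.<-trans is₂⊆is inc , λ j → refl
  p≡combination : ∀ j → toℚ p j ≡ w₁ * toℚ q₁ j + w₂ * toℚ q₂ j
  p≡combination j = trans (cong ℕ→ℚ (p≡ j)) (x≡ j)

newton-F⇔M : ∀ α n (x : Point n) → NewtonF α n x ⇔ NewtonM α n x
newton-F⇔M α n x = mk⇔
  (conv-bind (λ { p (β , β⟶α , tm) → term∈NewtonM β⟶α p tm }))
  (conv-mono (λ p tm → α , ε , tm))

theorem4p2 : (α : List ℕ) → IsComposition α → (n : ℕ) → 1 ℕ.≤ n →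
    ((x : Point n) → NewtonF α n x ⇔ NewtonM α n x)
    × ((v : Point n) → IsVertex (NewtonF α n) v ⇔
         Σ (ExpVec n) (λ γ → (γ ⁺ ≡ α) × (∀ j → v j ≡ toℚ γ j)))
theorem4p2 α posα n _ = newton-F⇔M α n , λ v → mk⇔ vertex⇒shape shape⇒vertex
  where
  vertex⇒shape : ∀ {v} → IsVertex (NewtonF α n) v → Σ (ExpVec n) (λ γ → (γ ⁺ ≡ α) × (∀ j → v j ≡ toℚ γ j))
  vertex⇒shape v-vertex with vertex⇒member (vertex-resp (newton-F⇔M α n) v-vertex)
  ... | γ , tγ , v≡γ = γ , term⇒⁺ α posα γ tγ , v≡γ
  shape⇒vertex : ∀ {v} → Σ (ExpVec n) (λ γ → (γ ⁺ ≡ α) × (∀ j → v j ≡ toℚ γ j)) → IsVertex (NewtonF α n) v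
  shape⇒vertex (γ , γ⁺≡α , v≡γ) =
    vertex-resp (λ x → ⇔-sym (newton-F⇔M α n x))
      (isolated⇒vertex (⁺⇒term γ α γ⁺≡α) (term-isolated α posα γ⁺≡α) v≡γ)
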